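{- Let $q$ be a prime power, $m,n,k,\rho$ positive integers and let $\mathcal{U}$ be a rank-$\rho$-saturating $[n,k]_{q^m/q}$ system. The following are equivalent: (1) $L_\mathcal{U}$ is not scattered; (2) $\mathcal{U}$ has an $\mathbb{F}_q$-basis $\{u_1,\ldots,u_n\}$ such that $u_n=\lambda\sum_{j=1}^{n-1} l_j u_j$ for some $l_1,\ldots,l_{n-1}\in\mathbb{F}_q$ and $\lambda\in\mathbb{F}_{q^m}\setminus\mathbb{F}_q$. If either of these holds, then $\mathcal{U}$ contains a rank-$\rho'$-saturating $[n-1,k]_{q^m/q}$ system with $\rho'\le\rho+1$; in particular, one such system is $\langle u_1,\ldots,u_{n-1}\rangle_{\mathbb{F}_q}$ for a basis as in (2).
   Context: An $[n,k]_{q^m/q}$ system is an $n$-dimensional $\mathbb{F}_q$-subspace $\mathcal{U}\le\mathbb{F}_{q^m}^k$ with $\langle\mathcal{U}\rangle_{\mathbb{F}_{q^m}}=\mathbb{F}_{q^m}^k$; its linear set is $L_\mathcal{U}=\{\langle u\rangle_{\mathbb{F}_{q^m}}:u\in\mathcal{U}\setminus\{0\}\}\subseteq\mathrm{PG}(k-1,q^m)$. For a point $P=\langle v\rangle_{\mathbb{F}_{q^m}}$, its weight is $\mathrm{wt}_\mathcal{U}(P)=\dim_{\mathbb{F}_q}(\mathcal{U}\cap\langle v\rangle_{\mathbb{F}_{q^m}})$; $L_\mathcal{U}$ is scattered if every point of $L_\mathcal{U}$ has weight $1$. A point set $\mathcal{S}$ of $\mathrm{PG}(k-1,q^m)$ is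 $r$-saturating if every point lies in the span of some $r+1$ points of $\mathcal{S}$ and $r$ is minimal with this property; $\mathcal{U}$ is rank-$\rho$-saturating if $L_\mathcal{U}$ is $(\rho-1)$-saturating. -}

module Defs where

open import Data.Nat using (ℕ; zero; suc; _^_; _<_)
open import Data.Nat.Primality using (Prime)
open import Data.Fin using (Fin; zero; suc)
open import Data.Vec using (Vec; map; zipWith; replicate)
open import Data.Bool using (Bool; T)
open import Data.Product using (Σ; ∃; ∃₂; _×_; _,_)
open import Relation.Nullary using (¬_)
open import Relation.Binary.PropositionalEquality using (_≡_)
open import Function.Bundles using (_⤖_)
import Algebra.Structures as AS

IsPrimePower : ℕ → Set
IsPrimePower q = ∃₂ λ p e → Prime p × q ≡ p ^ suc e

-- The extension F_{q^m} / F_q :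
-- K is a field with exactly q^m elements, and isFq singles out a
-- subfield with exactly q elements (this is F_q inside F_{q^m}).
record FieldExt (q m : ℕ) : Set₁ where
  infixl 6 _+_
  infixl 7 _*_
  field
    K       : Set
    _+_ _*_ : K → K → K
    -_      : K → K
    0# 1#   : K
    isCommutativeRing : AS.IsCommutativeRing (_≡_ {A = K}) _+_ _*_ -_ 0# 1#
    0≢1     : ¬ (0# ≡ 1#)
    inverse : ∀ x → ¬ (x ≡ 0#) → ∃ λ y → x * y ≡ 1#
    cardK   : Fin (q ^ m) ⤖ K
    isFq    : K → Bool
  Fq : K → Set
  Fq x = T (isFq x)
  field
    Fq-0    : Fq 0#
    Fq-1    : Fq 1#
    Fq-+    : ∀ {x y} → Fq x → Fq y → Fq (x + y)
    Fq-*    : ∀ {x y} → Fq x → Fq y → Fq (x * y)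
    Fq-neg  : ∀ {x} → Fq x → Fq (- x)
    Fq-inv  : ∀ {x y} → Fq x → x * y ≡ 1# → Fq y
    cardFq  : Fin q ⤖ Σ K Fq

module _ {q m : ℕ} (F : FieldExt q m) (k : ℕ) where
  open FieldExt F

  V : Set
  V = Vec K k

  0v : V
  0v = replicate k 0#

  _⊕_ : V → V → V
  _⊕_ = zipWith _+_

  _•_ : K → V → V
  c • v = map (c *_) v

  ∑ : ∀ {d} → (Fin d → V) → V
  ∑ {zero}  f = 0v
  ∑ {suc d} f = f zero ⊕ ∑ (λ i → f (suc i))

  InSpanFq : ∀ {d} → (Fin d → V) → V → Set
  InSpanFq b v = ∃ λ (c : Fin _ → K) → (∀ i → Fq (c i)) × v ≡ ∑ (λ i → c i • b i)

  InSpanK : ∀ {d} → (Fin d → V) → V → Set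
  InSpanK b v = ∃ λ (c : Fin _ → K) → v ≡ ∑ (λ i → c i • b i)

  LinIndepFq : ∀ {d} → (Fin d → V) → Set
  LinIndepFq b = ∀ (c : Fin _ → K) → (∀ i → Fq (c i)) →
                 ∑ (λ i → c i • b i) ≡ 0v → ∀ i → c i ≡ 0#

  IsBasisFq : ∀ {d} → (V → Set) → (Fin d → V) → Set
  IsBasisFq S b = (∀ i → S (b i)) × LinIndepFq b × (∀ v → S v → InSpanFq b v)

  HasDimFq : (V → Set) → ℕ → Set
  HasDimFq S d = ∃ λ (b : Fin d → V) → IsBasisFq S b

  IsFqSubspace : (V → Set) → Set
  IsFqSubspace S = S 0v × (∀ {x y} → S x → S y → S (x ⊕ y))
                        × (∀ {c x} → Fq c → S x → S (c • x))

  -- U is an [n,k]_{q^m/q} system: n-dim F_q-subspace whose F_{q^m}-span is F_{q^m}^k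
  IsSystem : ℕ → (V → Set) → Set
  IsSystem n U = IsFqSubspace U × HasDimFq U n ×
    (∀ v → ∃ λ d → ∃ λ (b : Fin d → V) → (∀ i → U (b i)) × InSpanK b v)

  Meet : (V → Set) → V → V → Set
  Meet U v x = U x × ∃ λ μ → x ≡ μ • v

  HasWeight : (V → Set) → V → ℕ → Set
  HasWeight U v w = HasDimFq (Meet U v) w

  Scattered : (V → Set) → Set
  Scattered U = ∀ u → U u → ¬ (u ≡ 0v) → HasWeight U u 1

  -- every point of PG(k-1,q^m) lies in the span of some r points of L_U
  -- (points of L_U given by representatives u ∈ U \ {0})
  SpannedBy : (V → Set) → ℕ → Set
  SpannedBy U r = ∀ v → ¬ (v ≡ 0v) →
    ∃ λ (s : Fin r → V) → (∀ i → U (s i) × ¬ (s i ≡ 0v)) × InSpanK s v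

  -- U is rank-ρ-saturating: L_U is (ρ-1)-saturating, i.e. ρ is minimal
  -- such that every point lies in the span of ρ points of L_U
  RankSaturating : (V → Set) → ℕ → Set
  RankSaturating U ρ = SpannedBy U ρ × (∀ r → r < ρ → ¬ SpannedBy U r)

  -- condition (2) for a given family u_0,…,u_n (n+1 vectors, last one u_n):
  -- u is an F_q-basis of U and u_last = λ Σ_j l_j u_j, l_j ∈ F_q, λ ∉ F_q
  Cond2Basis : ∀ {n} → (V → Set) → (Fin (suc n) → V) → Set
  Cond2Basis {n} U u = IsBasisFq U u ×
    ∃ λ (l : Fin n → K) → (∀ j → Fq (l j)) ×
    ∃ λ (lam : K) → ¬ Fq lam ×
      u (Data.Fin.fromℕ n) ≡ lam • ∑ (λ j → l j • u (Data.Fin.inject₁ j))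

-- Under (2), w = Σ l_j u_j and u_n = λ w both lie in U ∩ ⟨w⟩_{F_{q^m}}, whereas a point of weight one
-- only contains F_q-multiples of a single vector; hence λ ∈ F_q, a contradiction.  Conversely, a point
-- of weight at least two yields x ≠ 0 and μ ∉ F_q with x, μ x ∈ U.  Two Steinitz exchanges put x and
-- μ x into an F_q-basis of U, and a transposition moves μ x to the last place: this is (2) with l the
-- indicator of x.
-- Under (2), every element of U is y + a w with y ∈ U' = ⟨u_1, …, u_{n-1}⟩_{F_q} and a ∈ F_{q^m},
-- while w ∈ U'.  Replacing each of ρ spanning points of L_U by its U'-part (by w when that part is
-- zero) and adjoining w gives ρ + 1 spanning points of L_{U'}.
-- Constructively all of this rests on the finiteness of F_{q^m}: spans and the spanning property
-- are decided by exhaustive search, which turns ¬ scattered into an explicit point of weight at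
-- least two and produces the least ρ'.

module Submission where

open import Defs
open import Data.Nat using (ℕ; suc; _≤_)
open import Data.Fin using (Fin; inject₁)
open import Data.Product using (∃; _×_)
open import Relation.Nullary using (¬_)
open import Function.Bundles using (_⇔_)

open import Data.Nat using (zero; _<_)
open import Data.Fin using (zero; suc; toℕ; fromℕ; fromℕ<; punchIn)
import Data.Fin.Properties as FinP
import Data.Fin.Permutation.Components as PermC
open import Data.Fin.Permutation as Perm using (Permutation; _⟨$⟩ʳ_; _⟨$⟩ˡ_)
open import Data.Fin.Relation.Unary.Top using (view; ‵fromℕ; ‵inject₁)
open import Data.Vec using (Vec; []; _∷_; lookup; tabulate; map; zipWith; replicate)
import Data.Vec.Properties as VecP
open import Data.Vec.Functional using (updateAt; insertAt; removeAt)
open import Data.Vec.Functional.Properties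
  using (updateAt-updates; updateAt-minimal; insertAt-lookup; insertAt-punchIn)
open import Data.Product using (_,_; proj₁; proj₂)
open import Data.Sum using (_⊎_; inj₁; inj₂)
open import Function using (_∘_; const; id)
open import Data.Empty using (⊥-elim)
open import Data.Unit using (⊤)
open import Function.Bundles using (_⤖_; Bijection; mk⇔)
open import Relation.Nullary using (Dec; yes; no; ¬?; _×-dec_; _→-dec_)
open import Relation.Nullary.Decidable as Dec using (decidable-stable; T?)
open import Relation.Unary as Pred using ()
open import Relation.Binary.PropositionalEquality
open import Relation.Binary.Definitions using (DecidableEquality)
open import Algebra.Bundles using (CommutativeMonoid)
open import Algebra.Structures using (IsCommutativeRing)
import Algebra.Properties.CommutativeMonoid.Sum as MonoidSum

Searchable : Set → Set₁
Searchable A = ∀ {P : A → Set} → Pred.Decidable P → Dec (∃ P)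

search-⤖ : ∀ {n A} → Fin n ⤖ A → Searchable A
search-⤖ f {P} P? = Dec.map′ (λ (i , p) → to i , p) from-witness (FinP.any? (P? ∘ to))
  where
  open Bijection f using (to; strictlySurjective)
  from-witness : ∃ P → ∃ (P ∘ to)
  from-witness (a , p) = let (i , e) = strictlySurjective a in i , subst P (sym e) p

search-Vec : ∀ {A} → Searchable A → ∀ n → Searchable (Vec A n)
search-Vec sA zero    P? = Dec.map′ ([] ,_) (λ { ([] , p) → p }) (P? [])
search-Vec sA (suc n) P? =
  Dec.map′ (λ (a , v , p) → a ∷ v , p) (λ { (a ∷ v , p) → a , v , p })
           (sA (λ a → search-Vec sA n (P? ∘ (a ∷_))))

search-Fin→ : ∀ {A} → Searchable A → ∀ d {P : (Fin d → A) → Set} →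
              (∀ {f g} → f ≗ g → P f → P g) → Pred.Decidable P → Dec (∃ P)
search-Fin→ sA d resp P? =
  Dec.map′ (λ (v , p) → lookup v , p)
           (λ (f , p) → tabulate f , resp (sym ∘ VecP.lookup∘tabulate f) p)
           (search-Vec sA d (P? ∘ lookup))

search-∀ : ∀ {A} → Searchable A → ∀ {P : A → Set} → Pred.Decidable P → Dec (∀ a → P a)
search-∀ sA P? =
  Dec.map′ (λ ¬∃¬ a → decidable-stable (P? a) (λ ¬p → ¬∃¬ (a , ¬p)))
           (λ ∀p (a , ¬p) → ¬p (∀p a))
           (¬? (sA (¬? ∘ P?)))

⤖⇒≟ : ∀ {n} {A : Set} → Fin n ⤖ A → DecidableEquality A
⤖⇒≟ {A = A} f x y =
  Dec.map′ (λ e → trans (sym (to∘to⁻ x)) (trans (cong to e) (to∘to⁻ y))) (cong to⁻)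
           (to⁻ x FinP.≟ to⁻ y)
  where
  open Bijection f using (to; to⁻; strictlySurjective)
  to∘to⁻ : (a : A) → to (to⁻ a) ≡ a
  to∘to⁻ = proj₂ ∘ strictlySurjective

least-satisfying : ∀ {P : ℕ → Set} → Pred.Decidable P → ∀ {N} → P N →
        ∃ λ r → r ≤ N × P r × (∀ r' → r' < r → ¬ P r')
least-satisfying {P} P? {N} pN
  with FinP.¬∀⟶∃¬-smallest (suc N) (¬_ ∘ P ∘ toℕ) (¬? ∘ P? ∘ toℕ)
         (λ ∀¬P → ∀¬P (fromℕ N) (subst P (sym (FinP.toℕ-fromℕ N)) pN))
... | i , ¬¬Pi , below =
  toℕ i , FinP.toℕ≤pred[n] i , decidable-stable (P? (toℕ i)) ¬¬Pi ,
  λ r r<i → subst (¬_ ∘ P) (trans (FinP.toℕ-inject _) (FinP.toℕ-fromℕ< r<i)) (below (fromℕ< r<i))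

removeAt-updateAt : ∀ {A : Set} {d} (f : Fin (suc d) → A) j {g : A → A} →
                    removeAt (updateAt f j g) j ≗ removeAt f j
removeAt-updateAt f j i = updateAt-minimal (punchIn j i) j f (FinP.punchInᵢ≢i j i)

transpose-self : ∀ {n} (i j : Fin n) → PermC.transpose i j i ≡ j
transpose-self i j rewrite Dec.dec-true (i FinP.≟ i) refl = refl

punchIn-fromℕ : ∀ {n} (i : Fin n) → punchIn (fromℕ n) i ≡ inject₁ i
punchIn-fromℕ zero    = refl
punchIn-fromℕ (suc i) = cong suc (punchIn-fromℕ i)

module VectorSpace {q m : ℕ} (F : FieldExt q m) (k : ℕ) where
  open FieldExt F
  open IsCommutativeRing isCommutativeRing
    using (+-assoc; +-comm; +-identityˡ; +-identityʳ; *-assoc; *-identityˡ;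
           distribˡ; distribʳ; zeroˡ; zeroʳ)

  Vₖ : Set
  Vₖ = V F k

  0ᵥ : Vₖ
  0ᵥ = 0v F k

  infixl 6 _⊞_
  infixr 7 _·_

  _⊞_ : Vₖ → Vₖ → Vₖ
  _⊞_ = _⊕_ F k

  _·_ : K → Vₖ → Vₖ
  _·_ = _•_ F k

  ∑ₖ : ∀ {d} → (Fin d → Vₖ) → Vₖ
  ∑ₖ = ∑ F k

  ⊞-assoc : ∀ x y z → (x ⊞ y) ⊞ z ≡ x ⊞ (y ⊞ z)
  ⊞-assoc = VecP.zipWith-assoc +-assoc

  ⊞-comm : ∀ x y → x ⊞ y ≡ y ⊞ x
  ⊞-comm = VecP.zipWith-comm +-comm

  ⊞-identityˡ : ∀ x → 0ᵥ ⊞ x ≡ x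
  ⊞-identityˡ = VecP.zipWith-identityˡ +-identityˡ

  ⊞-identityʳ : ∀ x → x ⊞ 0ᵥ ≡ x
  ⊞-identityʳ = VecP.zipWith-identityʳ +-identityʳ

  ·-distribˡ-⊞ : ∀ a x y → a · (x ⊞ y) ≡ a · x ⊞ a · y
  ·-distribˡ-⊞ a = go
    where
    go : ∀ {n} (x y : Vec K n) →
         map (a *_) (zipWith _+_ x y) ≡
         zipWith _+_ (map (a *_) x) (map (a *_) y)
    go []       []       = refl
    go (x ∷ xs) (y ∷ ys) = cong₂ _∷_ (distribˡ a x y) (go xs ys)

  ·-distribʳ-+ : ∀ a b x → (a + b) · x ≡ a · x ⊞ b · x
  ·-distribʳ-+ a b = go
    where
    go : ∀ {n} (x : Vec K n) →
         map ((a + b) *_) x ≡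
         zipWith _+_ (map (a *_) x) (map (b *_) x)
    go []       = refl
    go (x ∷ xs) = cong₂ _∷_ (distribʳ x a b) (go xs)

  ·-assoc : ∀ a b x → a · (b · x) ≡ (a * b) · x
  ·-assoc a b x = trans (sym (VecP.map-∘ (a *_) (b *_) x)) (VecP.map-cong (sym ∘ *-assoc a b) x)

  ·-identityˡ : ∀ x → 1# · x ≡ x
  ·-identityˡ x = trans (VecP.map-cong *-identityˡ x) (VecP.map-id x)

  ·-zeroˡ : ∀ x → 0# · x ≡ 0ᵥ
  ·-zeroˡ x = trans (VecP.map-cong zeroˡ x) (VecP.map-const x 0#)

  ·-zeroʳ : ∀ a → a · 0ᵥ ≡ 0ᵥ
  ·-zeroʳ a = trans (VecP.map-replicate (a *_) 0# k) (cong (replicate k) (zeroʳ a))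

  ⊞-commutativeMonoid : CommutativeMonoid _ _
  ⊞-commutativeMonoid = record
    { Carrier = Vₖ ; _≈_ = _≡_ ; _∙_ = _⊞_ ; ε = 0ᵥ
    ; isCommutativeMonoid = record
      { isMonoid = record
        { isSemigroup = record
          { isMagma = record { isEquivalence = isEquivalence ; ∙-cong = cong₂ _⊞_ }
          ; assoc = ⊞-assoc }
        ; identity = ⊞-identityˡ , ⊞-identityʳ }
      ; comm = ⊞-comm } }

  module Σ = MonoidSum ⊞-commutativeMonoid

  ∑ₖ≡sum : ∀ {d} (f : Fin d → Vₖ) → ∑ₖ f ≡ Σ.sum f
  ∑ₖ≡sum {zero}  f = refl
  ∑ₖ≡sum {suc d} f = cong (f zero ⊞_) (∑ₖ≡sum (f ∘ suc))

  ∑ₖ-cong : ∀ {d} {f g : Fin d → Vₖ} → f ≗ g → ∑ₖ f ≡ ∑ₖ g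
  ∑ₖ-cong {zero}  f≗g = refl
  ∑ₖ-cong {suc d} f≗g = cong₂ _⊞_ (f≗g zero) (∑ₖ-cong (f≗g ∘ suc))

  ∑ₖ-zero : ∀ {d} {f : Fin d → Vₖ} → (∀ i → f i ≡ 0ᵥ) → ∑ₖ f ≡ 0ᵥ
  ∑ₖ-zero {d} f≗0 =
    trans (∑ₖ-cong f≗0) (trans (∑ₖ≡sum (const {B = Fin d} 0ᵥ)) (Σ.sum-replicate-zero d))

  ∑ₖ-distrib-⊞ : ∀ {d} (f g : Fin d → Vₖ) → ∑ₖ (λ i → f i ⊞ g i) ≡ ∑ₖ f ⊞ ∑ₖ g
  ∑ₖ-distrib-⊞ f g = begin
    ∑ₖ (λ i → f i ⊞ g i)    ≡⟨ ∑ₖ≡sum (λ i → f i ⊞ g i) ⟩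
    Σ.sum (λ i → f i ⊞ g i) ≡⟨ Σ.∑-distrib-+ f g ⟩
    Σ.sum f ⊞ Σ.sum g       ≡⟨ sym (cong₂ _⊞_ (∑ₖ≡sum f) (∑ₖ≡sum g)) ⟩
    ∑ₖ f ⊞ ∑ₖ g             ∎
    where open ≡-Reasoning

  ∑ₖ-remove : ∀ {d} (f : Fin (suc d) → Vₖ) i → ∑ₖ f ≡ f i ⊞ ∑ₖ (removeAt f i)
  ∑ₖ-remove f i =
    trans (∑ₖ≡sum f) (trans (Σ.sum-remove f) (cong (f i ⊞_) (sym (∑ₖ≡sum (removeAt f i)))))

  ∑ₖ-init-last : ∀ {d} (f : Fin (suc d) → Vₖ) → ∑ₖ f ≡ ∑ₖ (f ∘ inject₁) ⊞ f (fromℕ d)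
  ∑ₖ-init-last f =
    trans (∑ₖ≡sum f) (trans (Σ.sum-init-last f) (cong (_⊞ f (fromℕ _)) (sym (∑ₖ≡sum (f ∘ inject₁)))))

  ∑ₖ-permute : ∀ {d} (f : Fin d → Vₖ) (π : Permutation d d) → ∑ₖ f ≡ ∑ₖ (f ∘ (π ⟨$⟩ʳ_))
  ∑ₖ-permute f π =
    trans (∑ₖ≡sum f) (trans (Σ.∑-permute f π) (sym (∑ₖ≡sum (f ∘ (π ⟨$⟩ʳ_)))))

  ·-∑ₖ : ∀ {d} a (f : Fin d → Vₖ) → a · ∑ₖ f ≡ ∑ₖ (λ i → a · f i)
  ·-∑ₖ {zero}  a f = ·-zeroʳ a
  ·-∑ₖ {suc d} a f = trans (·-distribˡ-⊞ a _ _) (cong (a · f zero ⊞_) (·-∑ₖ a (f ∘ suc)))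

module FieldFacts {q m : ℕ} (F : FieldExt q m) where
  open FieldExt F
  open IsCommutativeRing isCommutativeRing using (*-assoc; *-identityʳ)

  _≟K_ : DecidableEquality K
  _≟K_ = ⤖⇒≟ cardK

  search-K : Searchable K
  search-K = search-⤖ cardK

  *-cancelʳ-≢0 : ∀ {a a' c} → c ≢ 0# → a * c ≡ a' * c → a ≡ a'
  *-cancelʳ-≢0 {a} {a'} {c} c≢0 ac≡a'c with inverse c c≢0
  ... | c⁻¹ , cc⁻¹≡1 = begin
    a              ≡⟨ sym (*-identityʳ a) ⟩
    a * 1#         ≡⟨ cong (a *_) (sym cc⁻¹≡1) ⟩
    a * (c * c⁻¹)  ≡⟨ sym (*-assoc a c c⁻¹) ⟩
    a * c * c⁻¹    ≡⟨ cong (_* c⁻¹) ac≡a'c ⟩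
    a' * c * c⁻¹   ≡⟨ *-assoc a' c c⁻¹ ⟩
    a' * (c * c⁻¹) ≡⟨ cong (a' *_) cc⁻¹≡1 ⟩
    a' * 1#        ≡⟨ *-identityʳ a' ⟩
    a'             ∎
    where open ≡-Reasoning

  Fq-quotient : ∀ {a c d} → Fq c → Fq d → c ≢ 0# → a * c ≡ d → Fq a
  Fq-quotient {a} {c} {d} Fq-c Fq-d c≢0 ac≡d with inverse c c≢0
  ... | c⁻¹ , cc⁻¹≡1 = subst Fq d*c⁻¹≡a (Fq-* Fq-d (Fq-inv Fq-c cc⁻¹≡1))
    where
    open ≡-Reasoning
    d*c⁻¹≡a : d * c⁻¹ ≡ a
    d*c⁻¹≡a = begin
      d * c⁻¹       ≡⟨ cong (_* c⁻¹) (sym ac≡d) ⟩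
      a * c * c⁻¹   ≡⟨ *-assoc a c c⁻¹ ⟩
      a * (c * c⁻¹) ≡⟨ cong (a *_) cc⁻¹≡1 ⟩
      a * 1#        ≡⟨ *-identityʳ a ⟩
      a             ∎

module LinearCombinations {q m : ℕ} (F : FieldExt q m) (k : ℕ) where
  open FieldExt F
  open FieldFacts F
  open VectorSpace F k public

  _≟ᵥ_ : DecidableEquality Vₖ
  _≟ᵥ_ = VecP.≡-dec _≟K_

  search-V : Searchable Vₖ
  search-V = search-Vec search-K k

  ·-cancelʳ-≢0 : ∀ {a a'} x → x ≢ 0ᵥ → a · x ≡ a' · x → a ≡ a'
  ·-cancelʳ-≢0 = go
    where
    go : ∀ {n a a'} (x : Vec K n) → x ≢ replicate n 0# →
         map (a *_) x ≡ map (a' *_) x → a ≡ a'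
    go []       x≢0 _ = ⊥-elim (x≢0 refl)
    go (c ∷ x) x≢0 ax≡a'x with c ≟K 0#
    ... | yes refl = go x (x≢0 ∘ cong (0# ∷_)) (VecP.∷-injectiveʳ ax≡a'x)
    ... | no c≢0   = *-cancelʳ-≢0 c≢0 (VecP.∷-injectiveˡ ax≡a'x)

  lincomb : ∀ {d} → (Fin d → K) → (Fin d → Vₖ) → Vₖ
  lincomb c b = ∑ₖ (λ i → c i · b i)

  lincomb-congˡ : ∀ {d} {c c' : Fin d → K} (b : Fin d → Vₖ) → c ≗ c' → lincomb c b ≡ lincomb c' b
  lincomb-congˡ b c≗c' = ∑ₖ-cong (λ i → cong (_· b i) (c≗c' i))

  lincomb-congʳ : ∀ {d} (c : Fin d → K) {b b' : Fin d → Vₖ} → b ≗ b' → lincomb c b ≡ lincomb c b'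
  lincomb-congʳ c b≗b' = ∑ₖ-cong (λ i → cong (c i ·_) (b≗b' i))

  lincomb-+ : ∀ {d} (c c' : Fin d → K) (b : Fin d → Vₖ) →
              lincomb c b ⊞ lincomb c' b ≡ lincomb (λ i → c i + c' i) b
  lincomb-+ c c' b =
    trans (sym (∑ₖ-distrib-⊞ (λ i → c i · b i) (λ i → c' i · b i)))
          (∑ₖ-cong (λ i → sym (·-distribʳ-+ (c i) (c' i) (b i))))

  ·-lincomb : ∀ {d} a (c : Fin d → K) (b : Fin d → Vₖ) → a · lincomb c b ≡ lincomb (λ i → a * c i) b
  ·-lincomb a c b = trans (·-∑ₖ a (λ i → c i · b i)) (∑ₖ-cong (λ i → ·-assoc a (c i) (b i)))

  lincomb-zero : ∀ {d} (b : Fin d → Vₖ) → lincomb (const 0#) b ≡ 0ᵥ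
  lincomb-zero b = ∑ₖ-zero (·-zeroˡ ∘ b)

  lincomb-remove : ∀ {d} (c : Fin (suc d) → K) (b : Fin (suc d) → Vₖ) j →
                   lincomb c b ≡ c j · b j ⊞ lincomb (removeAt c j) (removeAt b j)
  lincomb-remove c b = ∑ₖ-remove (λ i → c i · b i)

  lincomb-single : ∀ {d} {c : Fin d → K} (b : Fin d → Vₖ) j →
                   (∀ i → i ≢ j → c i ≡ 0#) → lincomb c b ≡ c j · b j
  lincomb-single {suc d} {c} b j c≡0 = begin
    lincomb c b                                        ≡⟨ lincomb-remove c b j ⟩
    c j · b j ⊞ lincomb (removeAt c j) (removeAt b j)  ≡⟨ cong (c j · b j ⊞_) (∑ₖ-zero rest≡0) ⟩
    c j · b j ⊞ 0ᵥ                                     ≡⟨ ⊞-identityʳ _ ⟩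
    c j · b j                                          ∎
    where
    open ≡-Reasoning
    rest≡0 : ∀ i → c (punchIn j i) · b (punchIn j i) ≡ 0ᵥ
    rest≡0 i = trans (cong (_· _) (c≡0 _ (FinP.punchInᵢ≢i j i))) (·-zeroˡ _)

  δ : ∀ {d} → Fin d → Fin d → K
  δ j = updateAt (const 0#) j (const 1#)

  δ-Fq : ∀ {d} (j i : Fin d) → Fq (δ j i)
  δ-Fq j i with i FinP.≟ j
  ... | yes refl = subst Fq (sym (updateAt-updates i (const 0#))) Fq-1
  ... | no i≢j   = subst Fq (sym (updateAt-minimal i j (const 0#) i≢j)) Fq-0

  lincomb-δ : ∀ {d} (b : Fin d → Vₖ) j → lincomb (δ j) b ≡ b j
  lincomb-δ b j = begin
    lincomb (δ j) b ≡⟨ lincomb-single b j (λ i i≢j → updateAt-minimal i j (const 0#) i≢j) ⟩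
    δ j j · b j     ≡⟨ cong (_· b j) (updateAt-updates j (const 0#)) ⟩
    1# · b j        ≡⟨ ·-identityˡ (b j) ⟩
    b j             ∎
    where open ≡-Reasoning

  lincomb-updateAt : ∀ {d} (c : Fin d → K) (b : Fin d → Vₖ) j v →
                     lincomb c (updateAt b j (const v)) ≡ lincomb (updateAt c j (const 0#)) b ⊞ c j · v
  lincomb-updateAt {suc d} c b j v = begin
    lincomb c b'                             ≡⟨ lincomb-remove c b' j ⟩
    c j · b' j ⊞ lincomb c⁻ (removeAt b' j)  ≡⟨ cong₂ _⊞_ (cong (c j ·_) (updateAt-updates j b))
                                                          (lincomb-congʳ c⁻ (removeAt-updateAt b j)) ⟩
    c j · v ⊞ lincomb c⁻ b⁻                  ≡⟨ ⊞-comm _ _ ⟩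
    lincomb c⁻ b⁻ ⊞ c j · v                  ≡⟨ cong (_⊞ c j · v) (sym c'-part) ⟩
    lincomb c' b ⊞ c j · v                   ∎
    where
    open ≡-Reasoning
    b' = updateAt b j (const v)
    c' = updateAt c j (const 0#)
    c⁻ = removeAt c j
    b⁻ = removeAt b j
    c'-part : lincomb c' b ≡ lincomb c⁻ b⁻
    c'-part = begin
      lincomb c' b                            ≡⟨ lincomb-remove c' b j ⟩
      c' j · b j ⊞ lincomb (removeAt c' j) b⁻ ≡⟨ cong₂ _⊞_ c'j·bj≡0
                                                            (lincomb-congˡ b⁻ (removeAt-updateAt c j)) ⟩
      0ᵥ ⊞ lincomb c⁻ b⁻                      ≡⟨ ⊞-identityˡ _ ⟩
      lincomb c⁻ b⁻                           ∎
      where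
      c'j·bj≡0 : c' j · b j ≡ 0ᵥ
      c'j·bj≡0 = trans (cong (_· b j) (updateAt-updates j c)) (·-zeroˡ (b j))

  lincomb-permute : ∀ {d} (c : Fin d → K) (b : Fin d → Vₖ) (π : Permutation d d) →
                    lincomb c b ≡ lincomb (c ∘ (π ⟨$⟩ʳ_)) (b ∘ (π ⟨$⟩ʳ_))
  lincomb-permute c b = ∑ₖ-permute (λ i → c i · b i)

module Spans {q m : ℕ} (F : FieldExt q m) (k : ℕ) where
  open FieldExt F
  open FieldFacts F
  open LinearCombinations F k public

  module _ (P : K → Set) (T : Vₖ → Set) (T-0 : T 0ᵥ) (T-⊞ : ∀ {x y} → T x → T y → T (x ⊞ y))
           (T-· : ∀ {a x} → P a → T x → T (a · x)) where

    lincomb-closed : ∀ {d} (c : Fin d → K) (b : Fin d → Vₖ) →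
                     (∀ i → P (c i)) → (∀ i → T (b i)) → T (lincomb c b)
    lincomb-closed {zero}  c b Pc Tb = T-0
    lincomb-closed {suc d} c b Pc Tb =
      T-⊞ (T-· (Pc zero) (Tb zero)) (lincomb-closed (c ∘ suc) (b ∘ suc) (Pc ∘ suc) (Tb ∘ suc))

  InSpanFq-isFqSubspace : ∀ {d} (b : Fin d → Vₖ) → IsFqSubspace F k (InSpanFq F k b)
  InSpanFq-isFqSubspace b =
      (const 0# , const Fq-0 , sym (lincomb-zero b))
    , (λ (c , Fq-c , x≡) (c' , Fq-c' , y≡) →
         (λ i → c i + c' i) , (λ i → Fq-+ (Fq-c i) (Fq-c' i)) ,
         trans (cong₂ _⊞_ x≡ y≡) (lincomb-+ c c' b))
    , (λ {a} Fq-a (c , Fq-c , x≡) →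
         (λ i → a * c i) , (λ i → Fq-* Fq-a (Fq-c i)) , trans (cong (a ·_) x≡) (·-lincomb a c b))

  InSpanFq⊆ : ∀ {T d} → IsFqSubspace F k T → (b : Fin d → Vₖ) → (∀ i → T (b i)) →
              ∀ {x} → InSpanFq F k b x → T x
  InSpanFq⊆ {T} (T-0 , T-⊞ , T-·) b Tb (c , Fq-c , x≡) =
    subst T (sym x≡) (lincomb-closed Fq T T-0 T-⊞ T-· c b Fq-c Tb)

  InSpanK-0 : ∀ {d} (b : Fin d → Vₖ) → InSpanK F k b 0ᵥ
  InSpanK-0 b = const 0# , sym (lincomb-zero b)

  InSpanK-⊞ : ∀ {d} (b : Fin d → Vₖ) {x y} → InSpanK F k b x → InSpanK F k b y → InSpanK F k b (x ⊞ y)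
  InSpanK-⊞ b (c , x≡) (c' , y≡) = (λ i → c i + c' i) , trans (cong₂ _⊞_ x≡ y≡) (lincomb-+ c c' b)

  InSpanK-· : ∀ {d} (b : Fin d → Vₖ) a {x} → InSpanK F k b x → InSpanK F k b (a · x)
  InSpanK-· b a (c , x≡) = (λ i → a * c i) , trans (cong (a ·_) x≡) (·-lincomb a c b)

  InSpanK-trans : ∀ {d d'} (b : Fin d → Vₖ) {s : Fin d' → Vₖ} → (∀ i → InSpanK F k b (s i)) →
                  ∀ {x} → InSpanK F k s x → InSpanK F k b x
  InSpanK-trans b {s} s⊆ (c , x≡) =
    subst (InSpanK F k b) (sym x≡)
      (lincomb-closed (const ⊤) (InSpanK F k b) (InSpanK-0 b) (InSpanK-⊞ b) (λ {a} _ → InSpanK-· b a)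
                      c s _ s⊆)

  InSpanFq-member : ∀ {d} (b : Fin d → Vₖ) j → InSpanFq F k b (b j)
  InSpanFq-member b j = δ j , δ-Fq j , sym (lincomb-δ b j)

  InSpanK-member : ∀ {d} (b : Fin d → Vₖ) j → InSpanK F k b (b j)
  InSpanK-member b j = δ j , sym (lincomb-δ b j)

  InSpanFq-init : ∀ {n} (b : Fin (suc n) → Vₖ) j → j ≢ fromℕ n → InSpanFq F k (b ∘ inject₁) (b j)
  InSpanFq-init b j j≢last with view j
  ... | ‵fromℕ     = ⊥-elim (j≢last refl)
  ... | ‵inject₁ t = InSpanFq-member (b ∘ inject₁) t

  InSpanFq⇒InSpanK : ∀ {d} {b : Fin d → Vₖ} {x} → InSpanFq F k b x → InSpanK F k b x
  InSpanFq⇒InSpanK (c , _ , x≡) = c , x≡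

  InSpanFq? : ∀ {d} (b : Fin d → Vₖ) → Pred.Decidable (InSpanFq F k b)
  InSpanFq? {d} b x =
    search-Fin→ search-K d
      (λ c≗c' (Fq-c , x≡) → (λ i → subst Fq (c≗c' i) (Fq-c i)) , trans x≡ (lincomb-congˡ b c≗c'))
      (λ c → FinP.all? (T? ∘ isFq ∘ c) ×-dec (x ≟ᵥ lincomb c b))

  InSpanK? : ∀ {d} (b : Fin d → Vₖ) → Pred.Decidable (InSpanK F k b)
  InSpanK? {d} b x =
    search-Fin→ search-K d (λ c≗c' x≡ → trans x≡ (lincomb-congˡ b c≗c')) (λ c → x ≟ᵥ lincomb c b)

  basis⇒decidable : ∀ {U d} {b : Fin d → Vₖ} → IsFqSubspace F k U → IsBasisFq F k U b → Pred.Decidable U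
  basis⇒decidable sub (b∈U , _ , spans) x = Dec.map′ (InSpanFq⊆ sub _ b∈U) (spans x) (InSpanFq? _ x)

module Bases {q m : ℕ} (F : FieldExt q m) (k : ℕ) where
  open FieldExt F
  open IsCommutativeRing isCommutativeRing
    using (+-assoc; +-identityˡ; +-identityʳ; *-assoc; *-comm; *-identityʳ; zeroˡ; -‿inverseˡ)
  open FieldFacts F
  open Spans F k public

  linIndep⇒≢0 : ∀ {d} {b : Fin d → Vₖ} → LinIndepFq F k b → ∀ j → b j ≢ 0ᵥ
  linIndep⇒≢0 {b = b} indep j bj≡0 =
    0≢1 (sym (trans (sym (updateAt-updates j (const 0#)))
                    (indep (δ j) (δ-Fq j) (trans (lincomb-δ b j) bj≡0) j)))

  nonzero-coefficient : ∀ {d} (c : Fin d → K) (b : Fin d → Vₖ) → lincomb c b ≢ 0ᵥ → ∃ λ j → c j ≢ 0#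
  nonzero-coefficient c b lincomb≢0 with FinP.any? (λ j → ¬? (c j ≟K 0#))
  ... | yes found = found
  ... | no none   = ⊥-elim (lincomb≢0 (trans (lincomb-congˡ b c≡0) (lincomb-zero b)))
    where
    c≡0 : ∀ i → c i ≡ 0#
    c≡0 i = decidable-stable (c i ≟K 0#) (λ ci≢0 → none (i , ci≢0))

  module _ {d} {c : Fin d → K} (Fq-c : ∀ i → Fq (c i)) (j : Fin d) where

    exchange-coords : (Fin d → K) → Fin d → K
    exchange-coords e i = updateAt e j (const 0#) i + e j * c i

    Fq-exchange-coords : ∀ {e} → (∀ i → Fq (e i)) → ∀ i → Fq (exchange-coords e i)
    Fq-exchange-coords {e} Fq-e i with i FinP.≟ j
    ... | yes refl = Fq-+ (subst Fq (sym (updateAt-updates i e)) Fq-0) (Fq-* (Fq-e i) (Fq-c i))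
    ... | no i≢j   = Fq-+ (subst Fq (sym (updateAt-minimal i j e i≢j)) (Fq-e i)) (Fq-* (Fq-e j) (Fq-c i))

    lincomb-exchanged : ∀ (b : Fin d → Vₖ) e →
                        lincomb e (updateAt b j (const (lincomb c b))) ≡ lincomb (exchange-coords e) b
    lincomb-exchanged b e = begin
      lincomb e (updateAt b j (const (lincomb c b)))
        ≡⟨ lincomb-updateAt e b j (lincomb c b) ⟩
      lincomb (updateAt e j (const 0#)) b ⊞ e j · lincomb c b
        ≡⟨ cong (_ ⊞_) (·-lincomb (e j) c b) ⟩
      lincomb (updateAt e j (const 0#)) b ⊞ lincomb (λ i → e j * c i) b
        ≡⟨ lincomb-+ _ _ b ⟩
      lincomb (exchange-coords e) b
        ∎
      where open ≡-Reasoning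

    exchange-linIndep : ∀ {b : Fin d → Vₖ} → c j ≢ 0# → LinIndepFq F k b →
                        LinIndepFq F k (updateAt b j (const (lincomb c b)))
    exchange-linIndep {b} cj≢0 indep e Fq-e e≡0 = e≡0′
      where
      open ≡-Reasoning
      coords≡0 : ∀ i → exchange-coords e i ≡ 0#
      coords≡0 =
        indep (exchange-coords e) (Fq-exchange-coords Fq-e) (trans (sym (lincomb-exchanged b e)) e≡0)
      ej≡0 : e j ≡ 0#
      ej≡0 = *-cancelʳ-≢0 cj≢0 (begin
        e j * c j           ≡⟨ sym (+-identityˡ _) ⟩
        0# + e j * c j      ≡⟨ cong (_+ e j * c j) (sym (updateAt-updates j e)) ⟩
        exchange-coords e j ≡⟨ coords≡0 j ⟩
        0#                  ≡⟨ sym (zeroˡ (c j)) ⟩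
        0# * c j            ∎)
      e≡0′ : ∀ i → e i ≡ 0#
      e≡0′ i with i FinP.≟ j
      ... | yes refl = ej≡0
      ... | no i≢j   = begin
        e i                 ≡⟨ sym (+-identityʳ (e i)) ⟩
        e i + 0#            ≡⟨ cong (e i +_) (sym (zeroˡ (c i))) ⟩
        e i + 0# * c i      ≡⟨ cong (λ a → e i + a * c i) (sym ej≡0) ⟩
        e i + e j * c i     ≡⟨ cong (_+ e j * c i) (sym (updateAt-minimal i j e i≢j)) ⟩
        exchange-coords e i ≡⟨ coords≡0 i ⟩
        0#                  ∎

    -- The j-th coordinate forces e j = a j / c j; the others are then corrected by e j * c i.
    exchange-coords-surjective : c j ≢ 0# → ∀ {a} → (∀ i → Fq (a i)) →
                                 ∃ λ e → (∀ i → Fq (e i)) × exchange-coords e ≗ a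
    exchange-coords-surjective cj≢0 {a} Fq-a with inverse (c j) cj≢0
    ... | cj⁻¹ , cjcj⁻¹≡1 = e , Fq-e , coords-e
      where
      open ≡-Reasoning
      t = a j * cj⁻¹
      e = updateAt (λ i → a i + - (t * c i)) j (const t)
      Fq-t : Fq t
      Fq-t = Fq-* (Fq-a j) (Fq-inv (Fq-c j) cjcj⁻¹≡1)
      Fq-e : ∀ i → Fq (e i)
      Fq-e i with i FinP.≟ j
      ... | yes refl = subst Fq (sym (updateAt-updates i _)) Fq-t
      ... | no i≢j   =
        subst Fq (sym (updateAt-minimal i j _ i≢j)) (Fq-+ (Fq-a i) (Fq-neg (Fq-* Fq-t (Fq-c i))))
      ej≡t : e j ≡ t
      ej≡t = updateAt-updates j _
      coords-e : ∀ i → exchange-coords e i ≡ a i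
      coords-e i with i FinP.≟ j
      ... | yes refl = begin
        updateAt e i (const 0#) i + e i * c i ≡⟨ cong₂ _+_ (updateAt-updates i e) (cong (_* c i) ej≡t) ⟩
        0# + a i * cj⁻¹ * c i                 ≡⟨ +-identityˡ _ ⟩
        a i * cj⁻¹ * c i                      ≡⟨ *-assoc (a i) cj⁻¹ (c i) ⟩
        a i * (cj⁻¹ * c i)                    ≡⟨ cong (a i *_) (trans (*-comm cj⁻¹ (c i)) cjcj⁻¹≡1) ⟩
        a i * 1#                              ≡⟨ *-identityʳ (a i) ⟩
        a i                                   ∎
      ... | no i≢j   = begin
        updateAt e j (const 0#) i + e j * c i ≡⟨ cong₂ _+_ (trans (updateAt-minimal i j e i≢j)
                                                                  (updateAt-minimal i j _ i≢j))
                                                            (cong (_* c i) ej≡t) ⟩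
        a i + - (t * c i) + t * c i           ≡⟨ +-assoc (a i) _ _ ⟩
        a i + (- (t * c i) + t * c i)         ≡⟨ cong (a i +_) (-‿inverseˡ (t * c i)) ⟩
        a i + 0#                              ≡⟨ +-identityʳ (a i) ⟩
        a i                                   ∎

  exchange : ∀ {U d} {b : Fin d → Vₖ} → IsFqSubspace F k U → IsBasisFq F k U b →
             ∀ {c : Fin d → K} → (∀ i → Fq (c i)) → ∀ {j} → c j ≢ 0# →
             IsBasisFq F k U (updateAt b j (const (lincomb c b)))
  exchange {U} {b = b} sub (b∈U , indep , spans) {c} Fq-c {j} cj≢0 =
    b'∈U , exchange-linIndep Fq-c j cj≢0 indep , spans'
    where
    b'∈U : ∀ i → U (updateAt b j (const (lincomb c b)) i)
    b'∈U i with i FinP.≟ j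
    ... | yes refl = subst U (sym (updateAt-updates i b)) (InSpanFq⊆ sub b b∈U (c , Fq-c , refl))
    ... | no i≢j   = subst U (sym (updateAt-minimal i j b i≢j)) (b∈U i)
    spans' : ∀ x → U x → InSpanFq F k (updateAt b j (const (lincomb c b))) x
    spans' x x∈U with spans x x∈U
    ... | a , Fq-a , x≡ with exchange-coords-surjective Fq-c j cj≢0 Fq-a
    ...   | e , Fq-e , coords≗a =
      e , Fq-e , trans x≡ (trans (lincomb-congˡ b (sym ∘ coords≗a)) (sym (lincomb-exchanged Fq-c j b e)))

  basis-permute : ∀ {U d} {b : Fin d → Vₖ} → IsBasisFq F k U b → (π : Permutation d d) →
                  IsBasisFq F k U (b ∘ (π ⟨$⟩ʳ_))
  basis-permute {b = b} (b∈U , indep , spans) π = b∈U ∘ (π ⟨$⟩ʳ_) , indep' , spans'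
    where
    indep' : LinIndepFq F k (b ∘ (π ⟨$⟩ʳ_))
    indep' e Fq-e e≡0 i =
      trans (cong e (sym (Perm.inverseˡ π))) (indep (e ∘ (π ⟨$⟩ˡ_)) (Fq-e ∘ _) e′≡0 (π ⟨$⟩ʳ i))
      where
      e′≡0 : lincomb (e ∘ (π ⟨$⟩ˡ_)) b ≡ 0ᵥ
      e′≡0 = trans (lincomb-permute _ b π)
                   (trans (lincomb-congˡ (b ∘ (π ⟨$⟩ʳ_)) (λ _ → cong e (Perm.inverseˡ π))) e≡0)
    spans' : ∀ x → _ → InSpanFq F k (b ∘ (π ⟨$⟩ʳ_)) x
    spans' x x∈U with spans x x∈U
    ... | a , Fq-a , x≡ = a ∘ (π ⟨$⟩ʳ_) , Fq-a ∘ _ , trans x≡ (lincomb-permute a b π)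

  linIndep-removeAt : ∀ {d} {b : Fin (suc d) → Vₖ} → LinIndepFq F k b →
                      ∀ j → LinIndepFq F k (removeAt b j)
  linIndep-removeAt {b = b} indep j e Fq-e e≡0 i =
    trans (sym (insertAt-punchIn e j 0# i)) (indep c Fq-c c≡0 (punchIn j i))
    where
    open ≡-Reasoning
    c = insertAt e j 0#
    Fq-c : ∀ i → Fq (c i)
    Fq-c i with j FinP.≟ i
    ... | yes refl = subst Fq (sym (insertAt-lookup e i 0#)) Fq-0
    ... | no j≢i   =
      subst Fq (trans (sym (insertAt-punchIn e j 0# _)) (cong c (FinP.punchIn-punchOut j≢i))) (Fq-e _)
    c≡0 : lincomb c b ≡ 0ᵥ
    c≡0 = begin
      lincomb c b                                        ≡⟨ lincomb-remove c b j ⟩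
      c j · b j ⊞ lincomb (removeAt c j) (removeAt b j)  ≡⟨ cong₂ _⊞_ cj·bj≡0 rest≡0 ⟩
      0ᵥ ⊞ 0ᵥ                                            ≡⟨ ⊞-identityˡ 0ᵥ ⟩
      0ᵥ                                                 ∎
      where
      cj·bj≡0 = trans (cong (_· b j) (insertAt-lookup e j 0#)) (·-zeroˡ (b j))
      rest≡0  = trans (lincomb-congˡ (removeAt b j) (insertAt-punchIn e j 0#)) e≡0

  linIndep-init : ∀ {d} {b : Fin (suc d) → Vₖ} → LinIndepFq F k b → LinIndepFq F k (b ∘ inject₁)
  linIndep-init {d} {b} indep e Fq-e e≡0 =
    linIndep-removeAt {b = b} indep (fromℕ d) e Fq-e
      (trans (lincomb-congʳ e (cong b ∘ punchIn-fromℕ)) e≡0)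

  nonzero-coefficient-off : ∀ {d} (c : Fin d → K) (b : Fin d → Vₖ) j →
                            lincomb c b ≢ c j · b j → ∃ λ i → i ≢ j × c i ≢ 0#
  nonzero-coefficient-off c b j lincomb≢cjbj with FinP.any? (λ i → ¬? (i FinP.≟ j) ×-dec ¬? (c i ≟K 0#))
  ... | yes found = found
  ... | no none   = ⊥-elim (lincomb≢cjbj (lincomb-single b j c≡0))
    where
    c≡0 : ∀ i → i ≢ j → c i ≡ 0#
    c≡0 i i≢j = decidable-stable (c i ≟K 0#) (λ ci≢0 → none (i , i≢j , ci≢0))

module Scatteredness {q m : ℕ} (F : FieldExt q m) (k : ℕ) where
  open FieldExt F
  open FieldFacts F
  open Bases F k public

  weight-one⇒Fq-multiplier : ∀ {U w μ} → HasWeight F k U w 1 → w ≢ 0ᵥ → U w → U (μ · w) → Fq μ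
  weight-one⇒Fq-multiplier {U} {w} {μ} (β , _ , β-indep , β-spans) w≢0 w∈U μw∈U
    with β-spans w (w∈U , 1# , sym (·-identityˡ w)) | β-spans (μ · w) (μw∈U , μ , refl)
  ... | c , Fq-c , w≡ | c' , Fq-c' , μw≡ =
    Fq-quotient (Fq-c zero) (Fq-c' zero) c≢0
      (·-cancelʳ-≢0 (β zero) (linIndep⇒≢0 {b = β} β-indep zero) μcβ≡c'β)
    where
    open ≡-Reasoning
    w≡cβ : w ≡ c zero · β zero
    w≡cβ = trans w≡ (⊞-identityʳ _)
    c≢0 : c zero ≢ 0#
    c≢0 c≡0 = w≢0 (trans w≡cβ (trans (cong (_· β zero) c≡0) (·-zeroˡ (β zero))))
    μcβ≡c'β : (μ * c zero) · β zero ≡ c' zero · β zero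
    μcβ≡c'β = begin
      (μ * c zero) · β zero  ≡⟨ sym (·-assoc μ (c zero) (β zero)) ⟩
      μ · (c zero · β zero)  ≡⟨ cong (μ ·_) (sym w≡cβ) ⟩
      μ · w                  ≡⟨ μw≡ ⟩
      c' zero · β zero ⊞ 0ᵥ  ≡⟨ ⊞-identityʳ _ ⟩
      c' zero · β zero       ∎

  Fq-multipliers⇒weight-one : ∀ {U u} → U u → u ≢ 0ᵥ → (∀ μ → U (μ · u) → Fq μ) → HasWeight F k U u 1
  Fq-multipliers⇒weight-one {U} {u} u∈U u≢0 Fq-multiplier =
    const u , (λ _ → u∈U , 1# , sym (·-identityˡ u)) , indep , spans
    where
    indep : LinIndepFq F k {1} (const u)
    indep c _ cu≡0 zero =
      ·-cancelʳ-≢0 u u≢0 (trans (sym (⊞-identityʳ _)) (trans cu≡0 (sym (·-zeroˡ u))))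
    spans : ∀ x → Meet F k U u x → InSpanFq F k {1} (const u) x
    spans x (x∈U , μ , x≡μu) =
      const μ , const (Fq-multiplier μ (subst U x≡μu x∈U)) , trans x≡μu (sym (⊞-identityʳ _))

  ¬scattered⇒non-Fq-multiplier : ∀ {U d} {b : Fin d → Vₖ} → IsFqSubspace F k U → IsBasisFq F k U b →
                                 ¬ Scattered F k U → ∃ λ x → U x × x ≢ 0ᵥ × ∃ λ μ → ¬ Fq μ × U (μ · x)
  ¬scattered⇒non-Fq-multiplier {U} sub basis ¬scattered
    with search-V (λ x → U? x ×-dec ¬? (x ≟ᵥ 0ᵥ) ×-dec search-K λ μ → ¬? (T? (isFq μ)) ×-dec U? (μ · x))
    where U? = basis⇒decidable sub basis
  ... | yes witness = witness
  ... | no none     = ⊥-elim (¬scattered λ u u∈U u≢0 → Fq-multipliers⇒weight-one u∈U u≢0 λ μ μu∈U →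
                        decidable-stable (T? (isFq μ)) (λ ¬Fqμ → none (u , u∈U , u≢0 , μ , ¬Fqμ , μu∈U)))

  BasisThroughMultiple : (Vₖ → Set) → ℕ → Vₖ → K → Set
  BasisThroughMultiple U d x μ =
    ∃ λ (b : Fin d → Vₖ) → IsBasisFq F k U b × ∃ λ i → ∃ λ j → i ≢ j × b i ≡ μ · x × b j ≡ x

  basis-through-multiple : ∀ {U d} {b : Fin d → Vₖ} → IsFqSubspace F k U → IsBasisFq F k U b →
                           ∀ {x μ} → U x → x ≢ 0ᵥ → ¬ Fq μ → U (μ · x) → BasisThroughMultiple U d x μ
  basis-through-multiple {U} {b = b} sub basis@(_ , _ , spans) {x} {μ} x∈U x≢0 ¬Fqμ μx∈U =
    let (c , Fq-c , x≡) = spans x x∈U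
        (j , cj≢0)      = nonzero-coefficient c b (x≢0 ∘ trans x≡)
    in  exchange-multiple (exchange sub basis Fq-c cj≢0) (trans (updateAt-updates j b) (sym x≡))
    where
    exchange-multiple : ∀ {d} {b₁ : Fin d → Vₖ} {j} → IsBasisFq F k U b₁ → b₁ j ≡ x →
                        BasisThroughMultiple U d x μ
    exchange-multiple {b₁ = b₁} {j} basis₁@(_ , _ , spans₁) b₁j≡x with spans₁ (μ · x) μx∈U
    ... | e , Fq-e , μx≡ with nonzero-coefficient-off e b₁ j μx-off-x
      where
      μx-off-x : lincomb e b₁ ≢ e j · b₁ j
      μx-off-x single = ¬Fqμ (subst Fq (sym μ≡ej) (Fq-e j))
        where
        μ≡ej : μ ≡ e j
        μ≡ej = ·-cancelʳ-≢0 x x≢0 (trans μx≡ (trans single (cong (e j ·_) b₁j≡x)))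
    ... | i , i≢j , ei≢0 =
      updateAt b₁ i (const (lincomb e b₁)) , exchange sub basis₁ Fq-e ei≢0 ,
      i , j , i≢j , trans (updateAt-updates i b₁) (sym μx≡) ,
      trans (updateAt-minimal j i b₁ (i≢j ∘ sym)) b₁j≡x

  cond2-of-basis-through-multiple : ∀ {U n x μ} → BasisThroughMultiple U (suc n) x μ → ¬ Fq μ →
                                    ∃ λ u → Cond2Basis F k U u
  cond2-of-basis-through-multiple {n = n} {x} {μ} (b , basis , i , j , i≢j , bi≡μx , bj≡x) ¬Fqμ =
    u , basis-permute basis π , l , Fq-l , μ , ¬Fqμ , last≡
    where
    π = Perm.transpose (fromℕ n) i
    u = b ∘ (π ⟨$⟩ʳ_)
    p = π ⟨$⟩ˡ j
    up≡x : u p ≡ x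
    up≡x = trans (cong b (Perm.inverseʳ π)) bj≡x
    p≢last : p ≢ fromℕ n
    p≢last p≡last =
      i≢j (trans (sym (transpose-self (fromℕ n) i))
                 (trans (cong (π ⟨$⟩ʳ_) (sym p≡last)) (Perm.inverseʳ π)))
    x∈span = InSpanFq-init u p p≢last
    l = proj₁ x∈span
    Fq-l = proj₁ (proj₂ x∈span)
    last≡ : u (fromℕ n) ≡ μ · lincomb l (u ∘ inject₁)
    last≡ = trans (cong b (transpose-self (fromℕ n) i))
                  (trans bi≡μx (cong (μ ·_) (trans (sym up≡x) (proj₂ (proj₂ x∈span)))))

  ¬scattered⇒cond2 : ∀ {U n} {b : Fin (suc n) → Vₖ} → IsFqSubspace F k U → IsBasisFq F k U b →
                     ¬ Scattered F k U → ∃ λ u → Cond2Basis F k U u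
  ¬scattered⇒cond2 {U} sub basis ¬scattered =
    from-multiplier (¬scattered⇒non-Fq-multiplier sub basis ¬scattered)
    where
    from-multiplier : (∃ λ x → U x × x ≢ 0ᵥ × ∃ λ μ → ¬ Fq μ × U (μ · x)) → ∃ λ u → Cond2Basis F k U u
    from-multiplier (x , x∈U , x≢0 , μ , ¬Fqμ , μx∈U) =
      cond2-of-basis-through-multiple (basis-through-multiple sub basis x∈U x≢0 ¬Fqμ μx∈U) ¬Fqμ

module Saturation {q m : ℕ} (F : FieldExt q m) (k : ℕ) where
  open Spans F k

  SpannedBy? : ∀ {U} → Pred.Decidable U → ∀ r → Dec (SpannedBy F k U r)
  SpannedBy? {U} U? r =
    search-∀ search-V λ v → ¬? (v ≟ᵥ 0ᵥ) →-dec
      search-Fin→ search-V r respects-≗ λ s →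
        FinP.all? (λ i → U? (s i) ×-dec ¬? (s i ≟ᵥ 0ᵥ)) ×-dec InSpanK? s v
    where
    respects-≗ : ∀ {v} {s s' : Fin r → Vₖ} → s ≗ s' →
                 (∀ i → U (s i) × s i ≢ 0ᵥ) × InSpanK F k s v →
                 (∀ i → U (s' i) × s' i ≢ 0ᵥ) × InSpanK F k s' v
    respects-≗ s≗s' (s-ok , c , v≡) =
      (λ i → subst (λ y → U y × y ≢ 0ᵥ) (s≗s' i) (s-ok i)) , c , trans v≡ (lincomb-congʳ c s≗s')

  minimal-rank : ∀ {U r} → Pred.Decidable U → SpannedBy F k U r →
                 ∃ λ ρ → ρ ≤ r × RankSaturating F k U ρ
  minimal-rank U? spanned with least-satisfying (SpannedBy? U?) spanned
  ... | ρ , ρ≤r , spannedρ , below = ρ , ρ≤r , spannedρ , below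

  module _ {U U' : Vₖ → Set} {w} (w∈U' : U' w) (w≢0 : w ≢ 0ᵥ)
           (U⊆U'+w : ∀ {x} → U x → ∃ λ y → U' y × ∃ λ a → x ≡ y ⊞ a · w) where

    replace-zero : Vₖ → Vₖ
    replace-zero y with y ≟ᵥ 0ᵥ
    ... | yes _ = w
    ... | no  _ = y

    replace-zero-ok : ∀ {y} → U' y → U' (replace-zero y) × replace-zero y ≢ 0ᵥ
    replace-zero-ok {y} y∈U' with y ≟ᵥ 0ᵥ
    ... | yes _   = w∈U' , w≢0
    ... | no  y≢0 = y∈U' , y≢0

    replace-zero-cases : ∀ y → y ≡ 0ᵥ ⊎ replace-zero y ≡ y
    replace-zero-cases y with y ≟ᵥ 0ᵥ
    ... | yes y≡0 = inj₁ y≡0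
    ... | no  _   = inj₂ refl

    spannedBy-suc : ∀ {ρ} → SpannedBy F k U ρ → SpannedBy F k U' (suc ρ)
    spannedBy-suc spanned v v≢0 with spanned v v≢0
    ... | s , s-ok , v∈⟨s⟩ = s' , s'-ok , InSpanK-trans s' s∈⟨s'⟩ v∈⟨s⟩
      where
      decomposition : ∀ i → ∃ λ y → U' y × ∃ λ a → s i ≡ y ⊞ a · w
      decomposition i = U⊆U'+w (proj₁ (s-ok i))
      s' : Fin (suc _) → Vₖ
      s' zero    = w
      s' (suc i) = replace-zero (proj₁ (decomposition i))
      s'-ok : ∀ i → U' (s' i) × s' i ≢ 0ᵥ
      s'-ok zero    = w∈U' , w≢0
      s'-ok (suc i) = replace-zero-ok (proj₁ (proj₂ (decomposition i)))
      y∈⟨s'⟩ : ∀ i → InSpanK F k s' (proj₁ (decomposition i))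
      y∈⟨s'⟩ i with replace-zero-cases (proj₁ (decomposition i))
      ... | inj₁ y≡0 = subst (InSpanK F k s') (sym y≡0) (InSpanK-0 s')
      ... | inj₂ y≡  = subst (InSpanK F k s') y≡ (InSpanK-member s' (suc i))
      s∈⟨s'⟩ : ∀ i → InSpanK F k s' (s i)
      s∈⟨s'⟩ i = let (_ , _ , a , s≡) = decomposition i in
        subst (InSpanK F k s') (sym s≡)
              (InSpanK-⊞ s' (y∈⟨s'⟩ i) (InSpanK-· s' a (InSpanK-member s' zero)))

module Condition2 {q m : ℕ} (F : FieldExt q m) (k : ℕ)
                  {U : V F k → Set} {n} (sys : IsSystem F k (suc n) U)
                  {u : Fin (suc n) → V F k} (basis : IsBasisFq F k U u) where
  open FieldExt F
  open Scatteredness F k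
  open Saturation F k

  private
    sub = proj₁ sys
    u∈U = proj₁ basis
    indep = proj₁ (proj₂ basis)
    spans = proj₂ (proj₂ basis)

  u' : Fin n → Vₖ
  u' = u ∘ inject₁

  U' : Vₖ → Set
  U' = InSpanFq F k u'

  U'⊆U : ∀ {x} → U' x → U x
  U'⊆U = InSpanFq⊆ sub u' (u∈U ∘ inject₁)

  module _ {l : Fin n → K} (Fq-l : ∀ j → Fq (l j))
           {μ : K} (last≡ : u (fromℕ n) ≡ μ · lincomb l u') where

    w : Vₖ
    w = lincomb l u'

    w∈U' : U' w
    w∈U' = l , Fq-l , refl

    w≢0 : w ≢ 0ᵥ
    w≢0 w≡0 = linIndep⇒≢0 {b = u} indep (fromℕ n) (trans last≡ (trans (cong (μ ·_) w≡0) (·-zeroʳ μ)))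

    ¬scattered : ¬ Fq μ → ¬ Scattered F k U
    ¬scattered ¬Fqμ scattered =
      ¬Fqμ (weight-one⇒Fq-multiplier (scattered w (U'⊆U w∈U') w≢0) w≢0 (U'⊆U w∈U')
                                     (subst U last≡ (u∈U (fromℕ n))))

    u∈⟨u'⟩ : ∀ i → InSpanK F k u' (u i)
    u∈⟨u'⟩ i with view i
    ... | ‵fromℕ     = subst (InSpanK F k u') (sym last≡) (InSpanK-· u' μ (l , refl))
    ... | ‵inject₁ t = InSpanK-member u' t

    U⊆⟨u'⟩ : ∀ {x} → U x → InSpanK F k u' x
    U⊆⟨u'⟩ {x} x∈U = InSpanK-trans u' u∈⟨u'⟩ (InSpanFq⇒InSpanK {b = u} (spans x x∈U))

    isSystem : IsSystem F k n U'
    isSystem =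
      InSpanFq-isFqSubspace u' , (u' , InSpanFq-member u' , linIndep-init {b = u} indep , λ _ → id) ,
      spanning
      where
      spanning : ∀ v → ∃ λ d → ∃ λ (s : Fin d → Vₖ) → (∀ i → U' (s i)) × InSpanK F k s v
      spanning v = let (_ , s , s∈U , v∈⟨s⟩) = proj₂ (proj₂ sys) v in
        n , u' , InSpanFq-member u' , InSpanK-trans u' (U⊆⟨u'⟩ ∘ s∈U) v∈⟨s⟩

    U⊆U'+w : ∀ {x} → U x → ∃ λ y → U' y × ∃ λ a → x ≡ y ⊞ a · w
    U⊆U'+w {x} x∈U with spans x x∈U
    ... | a , Fq-a , x≡ =
      lincomb (a ∘ inject₁) u' , (a ∘ inject₁ , Fq-a ∘ inject₁ , refl) , aₙ * μ , (begin
        x                                           ≡⟨ x≡ ⟩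
        lincomb a u                                 ≡⟨ ∑ₖ-init-last (λ i → a i · u i) ⟩
        lincomb (a ∘ inject₁) u' ⊞ aₙ · u (fromℕ n) ≡⟨ cong (λ y → _ ⊞ aₙ · y) last≡ ⟩
        lincomb (a ∘ inject₁) u' ⊞ aₙ · (μ · w)     ≡⟨ cong (_ ⊞_) (·-assoc aₙ μ w) ⟩
        lincomb (a ∘ inject₁) u' ⊞ (aₙ * μ) · w     ∎)
      where
      open ≡-Reasoning
      aₙ = a (fromℕ n)

    rankSaturating : ∀ {ρ} → SpannedBy F k U ρ → ∃ λ ρ' → ρ' ≤ suc ρ × RankSaturating F k U' ρ'
    rankSaturating spanned = minimal-rank (InSpanFq? u') (spannedBy-suc w∈U' w≢0 U⊆U'+w spanned)

lemma3p5 : ∀ {q m k ρ : ℕ} (n : ℕ) → IsPrimePower q → 1 ≤ m → 1 ≤ k → 1 ≤ ρ →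
    (F : FieldExt q m) → (U : V F k → Set) →
    IsSystem F k (suc n) U → RankSaturating F k U ρ →
    ((¬ Scattered F k U) ⇔ (∃ λ (u : Fin (suc n) → V F k) → Cond2Basis F k U u))
    × (∀ (u : Fin (suc n) → V F k) → Cond2Basis F k U u →
         (∀ x → InSpanFq F k (λ j → u (inject₁ j)) x → U x)
         × IsSystem F k n (InSpanFq F k (λ j → u (inject₁ j)))
         × ∃ λ ρ' → ρ' ≤ suc ρ × RankSaturating F k (InSpanFq F k (λ j → u (inject₁ j))) ρ')
lemma3p5 {k = k} n _ _ _ _ F U sys@(sub , (_ , basis) , _) (spanned , _) =
  mk⇔ (¬scattered⇒cond2 sub basis)
      (λ (_ , basis , _ , Fq-l , _ , ¬Fqμ , last≡) → Condition2.¬scattered F k sys basis Fq-l last≡ ¬Fqμ)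
  , λ u (basis , _ , Fq-l , _ , _ , last≡) →
      let open Condition2 F k sys basis in
      (λ _ → U'⊆U) , isSystem Fq-l last≡ , rankSaturating Fq-l last≡ spanned
  where
  open Scatteredness F k
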